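{- Let $m,n\geq 1$ and $0\leq k\leq n$ be integers. Then $\binom{mn}{n}$ divides $$\binom{2mk}{mk}\binom{mk}{k}\binom{2m(n-k)}{m(n-k)}\binom{m(n-k)}{n-k}.$$ -}

module Defs where

module Submission where

-- Write a = mk, b = m(n − k) and j = n − k, so that a + b = mn and k + j = n.
-- The proof rests on Gessel's super Catalan numbers
--     S(a, b) = (2a)! (2b)! / (a! b! (a + b)!),
-- which are integers: they satisfy S(a, 0) = C(2a, a) and the recurrence
-- S(a, b + 1) = 4 S(a, b) − S(a + 1, b).  Writing every binomial coefficient
-- as a quotient of factorials gives, for any k ≤ a and j ≤ b,
--     C(2a, a) C(a, k) C(2b, b) C(b, j)
--       = C(a + b, k + j) · S(a, b) C(k + j, k) C(a + b − k − j, a − k),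
-- so C(a + b, k + j) divides the left-hand side; the theorem is the
-- special case a = mk, b = m(n − k).

open import Data.Nat.Base as ℕ using (ℕ; zero; suc; _!)
open import Data.Nat.Combinatorics using (_C_; nCk≡n!/k![n-k]!; k![n∸k]!∣n!)
open import Relation.Binary.PropositionalEquality
open ≡-Reasoning

module Binomial where
  open import Data.Nat.Base using (_+_; _*_; _∸_; _≤_)
  open import Data.Nat.Properties using (m+n∸m≡n; m≤m+n; _!*_!≢0)
  open import Data.Nat.DivMod using (_/_; m/n*n≡m)

  binomial-factorials : ∀ x y {n} → x + y ≡ n → (n C x) * (x ! * y !) ≡ n !
  binomial-factorials x y refl = begin
    ((x + y) C x) * (x ! * y !)
      ≡⟨ cong (λ z → ((x + y) C x) * (x ! * z !)) (m+n∸m≡n x y) ⟨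
    ((x + y) C x) * (x ! * (x + y ∸ x) !)
      ≡⟨ cong (_* (x ! * (x + y ∸ x) !)) (nCk≡n!/k![n-k]! x≤x+y) ⟩
    (x + y) ! / (x ! * (x + y ∸ x) !) * (x ! * (x + y ∸ x) !)
      ≡⟨ m/n*n≡m (k![n∸k]!∣n! x≤x+y) ⟩
    (x + y) ! ∎
    where
    x≤x+y : x ≤ x + y
    x≤x+y = m≤m+n x y
    instance
      _ = x !* (x + y ∸ x) !≢0

open Binomial

module SuperCatalan where
  open import Data.Integer.Base using (ℤ; +_; ∣_∣; _+_; _*_; _-_)
  open import Data.Integer.Properties using (pos-+; pos-*; abs-*; *-cancelˡ-≡)
  open import Data.Nat.Properties using (+-suc; +-identityʳ)
  open import Data.Integer.Tactic.RingSolver using (solve-∀)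

  superCatalanℤ : ℕ → ℕ → ℤ
  superCatalanℤ m zero    = + ((m ℕ.+ m) C m)
  superCatalanℤ m (suc n) = + 4 * superCatalanℤ m n - superCatalanℤ (suc m) n

  _!ᶻ : ℕ → ℤ
  k !ᶻ = + (k !)

  !ᶻ-suc : ∀ k → suc k !ᶻ ≡ (+ 1 + + k) * k !ᶻ
  !ᶻ-suc k = pos-* (suc k) (k !)

  !ᶻ-suc-sum : ∀ m n → suc (m ℕ.+ n) !ᶻ ≡ (+ 1 + (+ m + + n)) * (m ℕ.+ n) !ᶻ
  !ᶻ-suc-sum m n = trans (!ᶻ-suc (m ℕ.+ n)) (cong (λ z → (+ 1 + z) * (m ℕ.+ n) !ᶻ) (pos-+ m n))

  !ᶻ-suc-double : ∀ k →
    (suc k ℕ.+ suc k) !ᶻ ≡ (+ 2 + (+ k + + k)) * ((+ 1 + (+ k + + k)) * (k ℕ.+ k) !ᶻ)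
  !ᶻ-suc-double k = begin
    (suc k ℕ.+ suc k) !ᶻ
      ≡⟨ cong _!ᶻ (cong suc (+-suc k k)) ⟩
    suc (suc (k ℕ.+ k)) !ᶻ
      ≡⟨ trans (!ᶻ-suc (suc (k ℕ.+ k))) (cong (+ suc (suc (k ℕ.+ k)) *_) (!ᶻ-suc (k ℕ.+ k))) ⟩
    (+ 2 + + (k ℕ.+ k)) * ((+ 1 + + (k ℕ.+ k)) * (k ℕ.+ k) !ᶻ)
      ≡⟨ cong (λ d → (+ 2 + d) * ((+ 1 + d) * (k ℕ.+ k) !ᶻ)) (pos-+ k k) ⟩
    (+ 2 + (+ k + + k)) * ((+ 1 + (+ k + + k)) * (k ℕ.+ k) !ᶻ) ∎

  -- The algebra of the inductive step: if s = S(m, n) and s' = S(m + 1, n)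
  -- satisfy the factorial identity, so does 4s − s' = S(m, n + 1), after
  -- multiplying by the nonzero factor 1 + m (it avoids division by m + 1).
  recurrence-step : ∀ (s s' m n fm fn fmn f2m f2n : ℤ) →
    s * (fm * fn * fmn) ≡ f2m * f2n →
    s' * ((+ 1 + m) * fm * fn * ((+ 1 + (m + n)) * fmn))
      ≡ (+ 2 + (m + m)) * ((+ 1 + (m + m)) * f2m) * f2n →
    (+ 1 + m) * ((+ 4 * s - s') * (fm * ((+ 1 + n) * fn) * ((+ 1 + (m + n)) * fmn)))
      ≡ (+ 1 + m) * (f2m * ((+ 2 + (n + n)) * ((+ 1 + (n + n)) * f2n)))
  recurrence-step s s' m n fm fn fmn f2m f2n hyp hyp' = begin
    (+ 1 + m) * ((+ 4 * s - s') * (fm * ((+ 1 + n) * fn) * ((+ 1 + (m + n)) * fmn)))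
      ≡⟨ expand s s' m n fm fn fmn ⟩
    + 4 * (+ 1 + m) * (+ 1 + n) * (+ 1 + (m + n)) * (s * (fm * fn * fmn))
      - (+ 1 + n) * (s' * ((+ 1 + m) * fm * fn * ((+ 1 + (m + n)) * fmn)))
      ≡⟨ cong₂ (λ u v → + 4 * (+ 1 + m) * (+ 1 + n) * (+ 1 + (m + n)) * u - (+ 1 + n) * v) hyp hyp' ⟩
    + 4 * (+ 1 + m) * (+ 1 + n) * (+ 1 + (m + n)) * (f2m * f2n)
      - (+ 1 + n) * ((+ 2 + (m + m)) * ((+ 1 + (m + m)) * f2m) * f2n)
      ≡⟨ collect m n f2m f2n ⟩
    (+ 1 + m) * (f2m * ((+ 2 + (n + n)) * ((+ 1 + (n + n)) * f2n))) ∎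
    where
    expand : ∀ s s' m n fm fn fmn →
      (+ 1 + m) * ((+ 4 * s - s') * (fm * ((+ 1 + n) * fn) * ((+ 1 + (m + n)) * fmn)))
        ≡ + 4 * (+ 1 + m) * (+ 1 + n) * (+ 1 + (m + n)) * (s * (fm * fn * fmn))
          - (+ 1 + n) * (s' * ((+ 1 + m) * fm * fn * ((+ 1 + (m + n)) * fmn)))
    expand = solve-∀
    -- 4(1 + m + n) − 2(1 + 2m) = 2(1 + 2n) is where the recurrence works.
    collect : ∀ m n f2m f2n →
      + 4 * (+ 1 + m) * (+ 1 + n) * (+ 1 + (m + n)) * (f2m * f2n)
        - (+ 1 + n) * ((+ 2 + (m + m)) * ((+ 1 + (m + m)) * f2m) * f2n)
        ≡ (+ 1 + m) * (f2m * ((+ 2 + (n + n)) * ((+ 1 + (n + n)) * f2n)))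
    collect = solve-∀

  superCatalanℤ-zero : ∀ m →
    superCatalanℤ m 0 * (m !ᶻ * 0 !ᶻ * (m ℕ.+ 0) !ᶻ) ≡ (m ℕ.+ m) !ᶻ * 0 !ᶻ
  superCatalanℤ-zero m rewrite +-identityʳ m = begin
    + c * (m !ᶻ * + 1 * m !ᶻ)     ≡⟨ drop-unit (+ c) (m !ᶻ) ⟩
    + c * (m !ᶻ * m !ᶻ) * + 1     ≡⟨ cong (λ z → + c * z * + 1) (pos-* (m !) (m !)) ⟨
    + c * + (m ! ℕ.* m !) * + 1   ≡⟨ cong (_* + 1) (pos-* c (m ! ℕ.* m !)) ⟨
    + (c ℕ.* (m ! ℕ.* m !)) * + 1 ≡⟨ cong (λ z → + z * + 1) (binomial-factorials m m refl) ⟩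
    (m ℕ.+ m) !ᶻ * + 1            ∎
    where
    c : ℕ
    c = (m ℕ.+ m) C m
    drop-unit : ∀ c f → c * (f * + 1 * f) ≡ c * (f * f) * + 1
    drop-unit = solve-∀

  superCatalanℤ-spec : ∀ n m →
    superCatalanℤ m n * (m !ᶻ * n !ᶻ * (m ℕ.+ n) !ᶻ) ≡ (m ℕ.+ m) !ᶻ * (n ℕ.+ n) !ᶻ
  superCatalanℤ-spec zero    m = superCatalanℤ-zero m
  superCatalanℤ-spec (suc n) m = *-cancelˡ-≡ (+ suc m) _ _ (begin
    + suc m * (superCatalanℤ m (suc n) * (m !ᶻ * suc n !ᶻ * (m ℕ.+ suc n) !ᶻ))
      ≡⟨ cong₂ (λ u v → + suc m * (superCatalanℤ m (suc n) * (m !ᶻ * u * v)))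
               (!ᶻ-suc n) (trans (cong _!ᶻ (+-suc m n)) (!ᶻ-suc-sum m n)) ⟩
    (+ 1 + + m) * ((+ 4 * superCatalanℤ m n - superCatalanℤ (suc m) n)
      * (m !ᶻ * ((+ 1 + + n) * n !ᶻ) * ((+ 1 + (+ m + + n)) * (m ℕ.+ n) !ᶻ)))
      ≡⟨ recurrence-step (superCatalanℤ m n) (superCatalanℤ (suc m) n) (+ m) (+ n)
           (m !ᶻ) (n !ᶻ) ((m ℕ.+ n) !ᶻ) ((m ℕ.+ m) !ᶻ) ((n ℕ.+ n) !ᶻ)
           (superCatalanℤ-spec n m) shifted ⟩
    (+ 1 + + m) * ((m ℕ.+ m) !ᶻ * ((+ 2 + (+ n + + n)) * ((+ 1 + (+ n + + n)) * (n ℕ.+ n) !ᶻ)))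
      ≡⟨ cong (λ z → + suc m * ((m ℕ.+ m) !ᶻ * z)) (!ᶻ-suc-double n) ⟨
    + suc m * ((m ℕ.+ m) !ᶻ * (suc n ℕ.+ suc n) !ᶻ) ∎)
    where
    shifted : superCatalanℤ (suc m) n * ((+ 1 + + m) * m !ᶻ * n !ᶻ * ((+ 1 + (+ m + + n)) * (m ℕ.+ n) !ᶻ))
      ≡ (+ 2 + (+ m + + m)) * ((+ 1 + (+ m + + m)) * (m ℕ.+ m) !ᶻ) * (n ℕ.+ n) !ᶻ
    shifted = begin
      superCatalanℤ (suc m) n * ((+ 1 + + m) * m !ᶻ * n !ᶻ * ((+ 1 + (+ m + + n)) * (m ℕ.+ n) !ᶻ))
        ≡⟨ cong₂ (λ u v → superCatalanℤ (suc m) n * (u * n !ᶻ * v)) (!ᶻ-suc m) (!ᶻ-suc-sum m n) ⟨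
      superCatalanℤ (suc m) n * (suc m !ᶻ * n !ᶻ * suc (m ℕ.+ n) !ᶻ)
        ≡⟨ superCatalanℤ-spec n (suc m) ⟩
      (suc m ℕ.+ suc m) !ᶻ * (n ℕ.+ n) !ᶻ
        ≡⟨ cong (_* (n ℕ.+ n) !ᶻ) (!ᶻ-suc-double m) ⟩
      (+ 2 + (+ m + + m)) * ((+ 1 + (+ m + + m)) * (m ℕ.+ m) !ᶻ) * (n ℕ.+ n) !ᶻ ∎

  superCatalan : ℕ → ℕ → ℕ
  superCatalan m n = ∣ superCatalanℤ m n ∣

  superCatalan-spec : ∀ m n →
    superCatalan m n ℕ.* (m ! ℕ.* n ! ℕ.* (m ℕ.+ n) !) ≡ (m ℕ.+ m) ! ℕ.* (n ℕ.+ n) !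
  superCatalan-spec m n = begin
    superCatalan m n ℕ.* (m ! ℕ.* n ! ℕ.* (m ℕ.+ n) !)
      ≡⟨ cong (λ z → superCatalan m n ℕ.* (z ℕ.* (m ℕ.+ n) !)) (abs-* (m !ᶻ) (n !ᶻ)) ⟨
    superCatalan m n ℕ.* (∣ m !ᶻ * n !ᶻ ∣ ℕ.* (m ℕ.+ n) !)
      ≡⟨ cong (superCatalan m n ℕ.*_) (abs-* (m !ᶻ * n !ᶻ) ((m ℕ.+ n) !ᶻ)) ⟨
    superCatalan m n ℕ.* ∣ m !ᶻ * n !ᶻ * (m ℕ.+ n) !ᶻ ∣
      ≡⟨ abs-* (superCatalanℤ m n) _ ⟨
    ∣ superCatalanℤ m n * (m !ᶻ * n !ᶻ * (m ℕ.+ n) !ᶻ) ∣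
      ≡⟨ cong ∣_∣ (superCatalanℤ-spec n m) ⟩
    ∣ (m ℕ.+ m) !ᶻ * (n ℕ.+ n) !ᶻ ∣
      ≡⟨ abs-* ((m ℕ.+ m) !ᶻ) ((n ℕ.+ n) !ᶻ) ⟩
    (m ℕ.+ m) ! ℕ.* (n ℕ.+ n) ! ∎

open SuperCatalan using (superCatalan; superCatalan-spec)

open import Defs
open import Data.Nat using (ℕ; _*_; _∸_; _≤_; _≥_)
open import Data.Nat.Divisibility using (_∣_)

open import Data.Nat.Base using (_+_)
open import Data.Nat.Divisibility using (m∣m*n)
open import Data.Nat.Properties
  using (_!≢0; m*n≢0; *-cancelʳ-≡; *-distribˡ-+; m+[n∸m]≡n; m≤n*m; m≤n⇒∃[o]m+o≡n)
open import Data.Nat.Tactic.RingSolver using (solve-∀)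
open import Data.Product using (_,_)

central-trinomial : ∀ k a' {a} → k + a' ≡ a →
  ((a + a) C a) * (a C k) * (a ! * (k ! * a' !)) ≡ (a + a) !
central-trinomial k a' {a} k+a'≡a = begin
  ((a + a) C a) * (a C k) * (a ! * (k ! * a' !))
    ≡⟨ regroup ((a + a) C a) (a C k) (a !) (k ! * a' !) ⟩
  ((a + a) C a) * (a ! * ((a C k) * (k ! * a' !)))
    ≡⟨ cong (λ z → ((a + a) C a) * (a ! * z)) (binomial-factorials k a' k+a'≡a) ⟩
  ((a + a) C a) * (a ! * a !)
    ≡⟨ binomial-factorials a a refl ⟩
  (a + a) ! ∎
  where
  regroup : ∀ c d x y → c * d * (x * y) ≡ c * (x * (d * y))
  regroup = solve-∀

binomial-product-factorisation : ∀ k a' j b' → let a = k + a' ; b = j + b' in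
  ((a + a) C a) * (a C k) * ((b + b) C b) * (b C j)
    ≡ ((a + b) C (k + j)) * (superCatalan a b * ((k + j) C k) * ((a' + b') C a'))
binomial-product-factorisation k a' j b' = *-cancelʳ-≡ _ _ denominators (begin
  ((a + a) C a) * (a C k) * ((b + b) C b) * (b C j) * denominators
    ≡⟨ split ((a + a) C a) (a C k) ((b + b) C b) (b C j) (a !) (k ! * a' !) (b !) (j ! * b' !) ⟩
  (((a + a) C a) * (a C k) * (a ! * (k ! * a' !)))
    * (((b + b) C b) * (b C j) * (b ! * (j ! * b' !)))
    ≡⟨ cong₂ _*_ (central-trinomial k a' refl) (central-trinomial j b' refl) ⟩
  (a + a) ! * (b + b) !
    ≡⟨ superCatalan-spec a b ⟨
  superCatalan a b * (a ! * b ! * (a + b) !)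
    ≡⟨ cong (λ z → superCatalan a b * (a ! * b ! * z)) (binomial-factorials (k + j) (a' + b') sums) ⟨
  superCatalan a b * (a ! * b ! * (((a + b) C (k + j)) * ((k + j) ! * (a' + b') !)))
    ≡⟨ cong₂ (λ u v → superCatalan a b * (a ! * b ! * (((a + b) C (k + j)) * (u * v))))
             (binomial-factorials k j refl) (binomial-factorials a' b' refl) ⟨
  superCatalan a b * (a ! * b ! * (((a + b) C (k + j))
    * ((((k + j) C k) * (k ! * j !)) * (((a' + b') C a') * (a' ! * b' !)))))
    ≡⟨ merge (superCatalan a b) (a !) (b !) ((a + b) C (k + j)) ((k + j) C k) ((a' + b') C a')
             (k !) (j !) (a' !) (b' !) ⟩
  ((a + b) C (k + j)) * (superCatalan a b * ((k + j) C k) * ((a' + b') C a')) * denominators ∎)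
  where
  a b : ℕ
  a = k + a'
  b = j + b'
  denominators : ℕ
  denominators = (a ! * (k ! * a' !)) * (b ! * (j ! * b' !))
  instance
    _ = m*n≢0 (a ! * (k ! * a' !)) (b ! * (j ! * b' !))
          {{m*n≢0 _ _ {{a !≢0}} {{m*n≢0 _ _ {{k !≢0}} {{a' !≢0}}}}}}
          {{m*n≢0 _ _ {{b !≢0}} {{m*n≢0 _ _ {{j !≢0}} {{b' !≢0}}}}}}
  sums : (k + j) + (a' + b') ≡ a + b
  sums = interchange k j a' b'
    where
    interchange : ∀ k j a' b' → (k + j) + (a' + b') ≡ (k + a') + (j + b')
    interchange = solve-∀
  split : ∀ c₁ c₂ c₃ c₄ x y u v →
    c₁ * c₂ * c₃ * c₄ * ((x * y) * (u * v)) ≡ (c₁ * c₂ * (x * y)) * (c₃ * c₄ * (u * v))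
  split = solve-∀
  merge : ∀ s fa fb c cn ca fk fj fa' fb' →
    s * (fa * fb * (c * ((cn * (fk * fj)) * (ca * (fa' * fb')))))
      ≡ c * (s * cn * ca) * ((fa * (fk * fa')) * (fb * (fj * fb')))
  merge = solve-∀

binomial-product-divisible : ∀ {k a j b} → k ≤ a → j ≤ b →
  ((a + b) C (k + j)) ∣ ((a + a) C a) * (a C k) * ((b + b) C b) * (b C j)
binomial-product-divisible {k} {_} {j} k≤a j≤b with m≤n⇒∃[o]m+o≡n k≤a | m≤n⇒∃[o]m+o≡n j≤b
... | a' , refl | b' , refl =
  subst (((k + a' + (j + b')) C (k + j)) ∣_) (sym (binomial-product-factorisation k a' j b')) (m∣m*n _)

lemma1 : (m n k : ℕ) → m ≥ 1 → n ≥ 1 → k ≤ n →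
    ((m * n) C n) ∣ (((2 * m * k) C (m * k)) * ((m * k) C k)
    * ((2 * m * (n ∸ k)) C (m * (n ∸ k))) * ((m * (n ∸ k)) C (n ∸ k)))
lemma1 m@(suc _) n k _ _ k≤n =
  subst₂ _∣_ (cong₂ _C_ total parts) (cong₂ binomials (twice m k) (twice m j))
    (binomial-product-divisible (m≤n*m k m) (m≤n*m j m))
  where
  j : ℕ
  j = n ∸ k
  parts : k + j ≡ n
  parts = m+[n∸m]≡n k≤n
  total : m * k + m * j ≡ m * n
  total = trans (sym (*-distribˡ-+ m k j)) (cong (m *_) parts)
  twice : ∀ c x → c * x + c * x ≡ 2 * c * x
  twice = solve-∀
  binomials : ℕ → ℕ → ℕ
  binomials u v = (u C (m * k)) * ((m * k) C k) * (v C (m * j)) * ((m * j) C j)
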